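{- For all $d,k,n\in\mathbb{N}$, every $n$-vertex graph $G$ with $\mathrm{tw}(G)\le k$ is contained in $H\boxtimes K_m$ for some graph $H$ with $\mathrm{td}(H)\le d$ and some integer $m\le (k+1)^{1-1/d}n^{1/d}$.
   Context: $\mathrm{tw}$ denotes tree-width. The tree-depth $\mathrm{td}(H)$ is the minimum number of vertices on a longest root-to-leaf path of a rooted forest $F$ such that $H$ is a subgraph of the closure of $F$ (the graph joining every ancestor–descendant pair of $F$). The strong product $A\boxtimes B$ has vertex set $V(A)\times V(B)$, with distinct $(v,x),(w,y)$ adjacent iff ($v=w$ and $xy\in E(B)$) or ($x=y$ and $vw\in E(A)$) or ($vw\in E(A)$ and $xy\in E(B)$). Contained means isomorphic to a subgraph. -}

module Defs where

open import Level using (0ℓ)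
open import Data.Nat using (ℕ; zero; suc; _+_; _≤_)
open import Data.Fin using (Fin; zero; suc; inject₁; fromℕ)
open import Data.Fin.Subset using (Subset; _∈_; ∣_∣)
open import Data.Maybe using (Maybe; just; nothing)
open import Data.Product using (Σ; ∃; _×_; _,_)
open import Data.Sum using (_⊎_)
open import Data.Empty using (⊥)
open import Relation.Nullary using (¬_)
open import Relation.Binary.PropositionalEquality using (_≡_; _≢_)
open import Relation.Binary.Construct.Closure.ReflexiveTransitive using (Star)
open import Relation.Binary.Construct.Closure.Transitive using (TransClosure)
open import Function.Definitions using (Injective)

record Graph : Set₁ where
  field
    V     : Set
    Adj   : V → V → Set
    sym   : ∀ {u v} → Adj u v → Adj v u
    irrefl : ∀ {u} → ¬ Adj u u
open Graph public

record FinGraph (n : ℕ) : Set₁ where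
  field
    adj    : Fin n → Fin n → Set
    adjSym : ∀ {u v} → adj u v → adj v u
    adjIrr : ∀ {u} → ¬ adj u u
open FinGraph public

toGraph : ∀ {n} → FinGraph n → Graph
toGraph {n} G = record { V = Fin n ; Adj = adj G ; sym = adjSym G ; irrefl = adjIrr G }

Complete : ℕ → Graph
Complete m = record
  { V = Fin m ; Adj = λ x y → x ≢ y
  ; sym = λ p q → p (Relation.Binary.PropositionalEquality.sym q)
  ; irrefl = λ p → p Relation.Binary.PropositionalEquality.refl }

StrongAdj : (A B : Graph) → V A × V B → V A × V B → Set
StrongAdj A B (v , x) (w , y) =
  (v ≡ w × Adj B x y) ⊎ ((x ≡ y × Adj A v w) ⊎ (Adj A v w × Adj B x y))

_⊠_ : Graph → Graph → Graph
A ⊠ B = record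
  { V = V A × V B
  ; Adj = StrongAdj A B
  ; sym = s
  ; irrefl = i }
  where
  open Relation.Binary.PropositionalEquality using (refl)
  s : ∀ {p q} → StrongAdj A B p q → StrongAdj A B q p
  s (Data.Sum.inj₁ (refl , e)) = Data.Sum.inj₁ (refl , Graph.sym B e)
  s (Data.Sum.inj₂ (Data.Sum.inj₁ (refl , e))) = Data.Sum.inj₂ (Data.Sum.inj₁ (refl , Graph.sym A e))
  s (Data.Sum.inj₂ (Data.Sum.inj₂ (e , f))) = Data.Sum.inj₂ (Data.Sum.inj₂ (Graph.sym A e , Graph.sym B f))
  i : ∀ {p} → ¬ StrongAdj A B p p
  i (Data.Sum.inj₁ (_ , e)) = Graph.irrefl B e
  i (Data.Sum.inj₂ (Data.Sum.inj₁ (_ , e))) = Graph.irrefl A e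
  i (Data.Sum.inj₂ (Data.Sum.inj₂ (e , _))) = Graph.irrefl A e

Contained : Graph → Graph → Set
Contained G H = Σ (V G → V H) λ f → Injective _≡_ _≡_ f × (∀ {u v} → Adj G u v → Adj H (f u) (f v))

Connected : ∀ {t} → FinGraph t → Set
Connected T = ∀ u v → Star (adj T) u v

HasCycle : ∀ {t} → FinGraph t → Set
HasCycle {t} T = Σ ℕ λ l → Σ (Fin (suc (suc (suc l))) → Fin t) λ c →
  Injective _≡_ _≡_ c ×
  (∀ (i : Fin (suc (suc l))) → adj T (c (inject₁ i)) (c (suc i))) ×
  adj T (c (fromℕ (suc (suc l)))) (c zero)

IsTree : ∀ {t} → FinGraph t → Set
IsTree T = Connected T × ¬ HasCycle T

record TreeDecomposition {n : ℕ} (G : FinGraph n) (k : ℕ) : Set₁ where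
  field
    t       : ℕ
    T       : FinGraph t
    isTree  : IsTree T
    bag     : Fin t → Subset n
    bagSize : ∀ i → ∣ bag i ∣ ≤ suc k
    covV    : ∀ (x : Fin n) → ∃ λ i → x ∈ bag i
    covE    : ∀ {x y : Fin n} → adj G x y → ∃ λ i → x ∈ bag i × y ∈ bag i
    subtree : ∀ (x : Fin n) {i j : Fin t} → x ∈ bag i → x ∈ bag j →
              Star (λ a b → adj T a b × (x ∈ bag a × x ∈ bag b)) i j

TreewidthAtMost : ∀ {n} → FinGraph n → ℕ → Set₁
TreewidthAtMost G k = TreeDecomposition G k

-- A rooted forest on Fin h given by a parent map (nothing = root) together
-- with a depth function: depth u = number of vertices on the path from the
-- root to u (the existence of such a function forces acyclicity).
record RootedForest (h : ℕ) : Set where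
  field
    parent     : Fin h → Maybe (Fin h)
    depth      : Fin h → ℕ
    depthRoot  : ∀ u → parent u ≡ nothing → depth u ≡ 1
    depthChild : ∀ u w → parent u ≡ just w → depth u ≡ suc (depth w)
open RootedForest public

Ancestor : ∀ {h} → RootedForest h → Fin h → Fin h → Set
Ancestor F w u = TransClosure (λ a b → parent F b ≡ just a) w u

InClosure : ∀ {h} → FinGraph h → RootedForest h → Set
InClosure H F = ∀ {u v} → adj H u v → Ancestor F u v ⊎ Ancestor F v u

TreedepthAtMost : ∀ {h} → FinGraph h → ℕ → Set
TreedepthAtMost {h} H d = Σ (RootedForest h) λ F → InClosure H F × (∀ u → depth F u ≤ d)

-- Root a tree decomposition of width k. Cutting off the subtree of a deepest node whose subtree meets X
-- in more than s vertices removes one bag of at most k + 1 vertices and, repeated, splits X into pieces of at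
-- most s vertices; the number of bags is at most |X|/(s + 1). Applying this d times with the scales
-- capacity k m j, each separator has at most m vertices: they become a single new root of H, told apart by
-- the K_m coordinate, and the pieces hang below it. So H has tree-depth ≤ d, and since
-- 1 + capacity k m (d - 1) = (m + 1)(⌊m/(k+1)⌋ + 1)^(d-1) ≥ (m + 1)^d / (k + 1)^(d-1), the largest m with
-- m^d ≤ (k+1)^(d-1) n has capacity at least n.

module Submission where

open import Data.Bool using (Bool; true; false; _∧_; _∨_; not; if_then_else_)
open import Data.Bool.Properties using (∧-conicalˡ; ∧-conicalʳ; ∨-conicalˡ; ∨-conicalʳ; ∧-zeroʳ; ¬-not)
open import Data.Empty using (⊥; ⊥-elim)
open import Function using (id; _∘_)
open import Data.Fin as Fin using (Fin; zero; suc; toℕ; fromℕ<; inject₁; fromℕ)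
import Data.Fin.Properties as Finₚ
open import Data.Fin.Subset using (_∈_)
open import Data.Maybe using (Maybe; just; nothing; maybe′; fromMaybe; _<∣>_)
open import Data.Maybe.Properties using (just-injective)
open import Data.Nat
open import Data.Nat.DivMod using (_/_; _%_; m≡m%n+[m/n]*n; m%n<n; m/n*n≤m)
open import Data.Nat.Properties
open import Data.Product using (Σ; ∃; _×_; _,_; proj₁; proj₂)
open import Data.Sum using (_⊎_; inj₁; inj₂; map₂)
open import Data.Vec as Vec using (Vec; []; _∷_; lookup)
open import Data.Vec.Properties using ([]=⇒lookup; lookup⇒[]=)
open import Relation.Binary.Construct.Closure.ReflexiveTransitive using (Star; ε; _◅_; _◅◅_)
open import Relation.Binary.Construct.Closure.Transitive using (TransClosure; [_]; _∷_; _∷ʳ_)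
open import Relation.Binary.Definitions using (tri<; tri≈; tri>)
open import Relation.Binary.PropositionalEquality
open import Relation.Nullary using (¬_; Dec; yes; no; does)
open import Relation.Nullary.Decidable using (dec-true; dec-false)
import Algebra.Properties.CommutativeSemigroup as CommSemigroupProperties

open import Defs hiding (sym)

open CommSemigroupProperties *-commutativeSemigroup using () renaming (interchange to *-interchange)

true≢false : ∀ {b} → b ≡ true → b ≡ false → ⊥
true≢false refl ()

does-true : ∀ {A : Set} (a? : Dec A) → does a? ≡ true → A
does-true (yes a) _ = a

true⊎false : ∀ b → b ≡ true ⊎ b ≡ false
true⊎false true  = inj₁ refl
true⊎false false = inj₂ refl

∧-intro : ∀ {a b} → a ≡ true → b ≡ true → a ∧ b ≡ true
∧-intro refl refl = refl

count : ∀ {n} → (Fin n → Bool) → ℕ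
count {zero}  p = 0
count {suc n} p = (if p zero then suc else id) (count (p ∘ suc))

count-mono : ∀ {n} (p q : Fin n → Bool) → (∀ x → p x ≡ true → q x ≡ true) → count p ≤ count q
count-mono {zero}  p q p⊆q = z≤n
count-mono {suc n} p q p⊆q with p zero in p₀ | q zero in q₀
... | true  | true  = s≤s (count-mono (p ∘ suc) (q ∘ suc) (λ x → p⊆q (suc x)))
... | true  | false = ⊥-elim (true≢false (p⊆q zero p₀) q₀)
... | false | true  = m≤n⇒m≤1+n (count-mono (p ∘ suc) (q ∘ suc) (λ x → p⊆q (suc x)))
... | false | false = count-mono (p ∘ suc) (q ∘ suc) (λ x → p⊆q (suc x))

count-none : ∀ {n} (p : Fin n → Bool) → (∀ x → p x ≡ false) → count p ≡ 0
count-none {zero}  p none = refl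
count-none {suc n} p none rewrite none zero = count-none (p ∘ suc) (λ x → none (suc x))

count≤n : ∀ {n} (p : Fin n → Bool) → count p ≤ n
count≤n {zero}  p = z≤n
count≤n {suc n} p with p zero
... | true  = s≤s (count≤n (p ∘ suc))
... | false = m≤n⇒m≤1+n (count≤n (p ∘ suc))

count-split : ∀ {n} (p q : Fin n → Bool) →
              count p ≡ count (λ x → p x ∧ q x) + count (λ x → p x ∧ not (q x))
count-split {zero}  p q = refl
count-split {suc n} p q with p zero | q zero
... | true  | true  = cong suc (count-split (p ∘ suc) (q ∘ suc))
... | true  | false = trans (cong suc (count-split (p ∘ suc) (q ∘ suc))) (sym (+-suc _ _))
... | false | _     = count-split (p ∘ suc) (q ∘ suc)

count-∨ : ∀ {n} (p q : Fin n → Bool) → count (λ x → p x ∨ q x) ≤ count p + count q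
count-∨ {zero}  p q = z≤n
count-∨ {suc n} p q with p zero | q zero
... | true  | true  = s≤s (≤-trans (count-∨ (p ∘ suc) (q ∘ suc))
                                 (≤-trans (m≤n+m _ 1) (≤-reflexive (sym (+-suc _ _)))))
... | true  | false = s≤s (count-∨ (p ∘ suc) (q ∘ suc))
... | false | true  = ≤-trans (s≤s (count-∨ (p ∘ suc) (q ∘ suc))) (≤-reflexive (sym (+-suc _ _)))
... | false | false = count-∨ (p ∘ suc) (q ∘ suc)

count-< : ∀ {n} (p q : Fin n → Bool) → (∀ x → p x ≡ true → q x ≡ true) →
          ∀ z → q z ≡ true → p z ≡ false → count p < count q
count-< {suc n} p q p⊆q zero qz pz rewrite qz | pz = s≤s (count-mono (p ∘ suc) (q ∘ suc) (λ x → p⊆q (suc x)))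
count-< {suc n} p q p⊆q (suc z) qz pz with p zero in p₀ | q zero in q₀
... | true  | true  = s≤s (count-< (p ∘ suc) (q ∘ suc) (λ x → p⊆q (suc x)) z qz pz)
... | true  | false = ⊥-elim (true≢false (p⊆q zero p₀) q₀)
... | false | true  = m≤n⇒m≤1+n (count-< (p ∘ suc) (q ∘ suc) (λ x → p⊆q (suc x)) z qz pz)
... | false | false = count-< (p ∘ suc) (q ∘ suc) (λ x → p⊆q (suc x)) z qz pz

count-lookup : ∀ {n} (b : Vec Bool n) → count (lookup b) ≡ Vec.count (Data.Bool._≟ true) b
count-lookup []          = refl
count-lookup (true ∷ b)  = cong suc (count-lookup b)
count-lookup (false ∷ b) = count-lookup b

rank : ∀ {n} → (Fin n → Bool) → Fin n → ℕ
rank p x = count (λ y → p y ∧ does (y Finₚ.<? x))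

private
  before-self : ∀ {n} (p : Fin n → Bool) x → p x ∧ does (x Finₚ.<? x) ≡ false
  before-self p x rewrite dec-false (x Finₚ.<? x) (Finₚ.<-irrefl refl) = ∧-zeroʳ (p x)

rank<count : ∀ {n} (p : Fin n → Bool) x → p x ≡ true → rank p x < count p
rank<count p x px = count-< _ p (λ y e → ∧-conicalˡ (p y) _ e) x px (before-self p x)

rank-monotone : ∀ {n} (p : Fin n → Bool) {x y} → p x ≡ true → x Fin.< y → rank p x < rank p y
rank-monotone p {x} {y} px x<y = count-< _ _ before⇒before x (∧-intro px (dec-true (x Finₚ.<? y) x<y)) (before-self p x)
  where
  before⇒before : ∀ z → p z ∧ does (z Finₚ.<? x) ≡ true → p z ∧ does (z Finₚ.<? y) ≡ true
  before⇒before z e = ∧-intro (∧-conicalˡ (p z) _ e)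
    (dec-true (z Finₚ.<? y) (Finₚ.<-trans (does-true (z Finₚ.<? x) (∧-conicalʳ (p z) _ e)) x<y))

rank-injective : ∀ {n} (p : Fin n → Bool) {x y} → p x ≡ true → p y ≡ true → rank p x ≡ rank p y → x ≡ y
rank-injective p {x} {y} px py e with Finₚ.<-cmp x y
... | tri< x<y _ _ = ⊥-elim (<-irrefl e (rank-monotone p px x<y))
... | tri≈ _ x≡y _ = x≡y
... | tri> _ _ y<x = ⊥-elim (<-irrefl (sym e) (rank-monotone p py y<x))

anyTrue? : ∀ {n} (p : Fin n → Bool) → Dec (∃ λ x → p x ≡ true)
anyTrue? p = Finₚ.any? (λ x → p x Data.Bool.≟ true)

noneTrue : ∀ {n} (p : Fin n → Bool) → ¬ (∃ λ x → p x ≡ true) → ∀ x → p x ≡ false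
noneTrue p none x = ¬-not (λ e → none (x , e))

anyᵇ : ∀ {n} → (Fin n → Bool) → Bool
anyᵇ p = does (anyTrue? p)

choose : ∀ {n} → (Fin n → Bool) → Fin n → Fin n
choose p default with anyTrue? p
... | yes (x , _) = x
... | no _        = default

choose-true : ∀ {n} (p : Fin n → Bool) default → anyᵇ p ≡ true → p (choose p default) ≡ true
choose-true p default e with anyTrue? p
... | yes (_ , px) = px

maximiser : ∀ {n} (p : Fin n → Bool) (w : Fin n → ℕ) i₀ → p i₀ ≡ true →
            ∃ λ i → p i ≡ true × (∀ j → p j ≡ true → w j ≤ w i)
maximiser {suc n} p w i₀ pi₀ with anyTrue? (p ∘ suc)
maximiser {suc n} p w zero pi₀ | no none =
  zero , pi₀ , λ { zero _ → ≤-refl ; (suc j) pj → ⊥-elim (none (j , pj)) }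
maximiser {suc n} p w (suc i₀) pi₀ | no none = ⊥-elim (none (i₀ , pi₀))
maximiser {suc n} p w _ _ | yes (j₁ , pj₁) with maximiser (p ∘ suc) (w ∘ suc) j₁ pj₁ | p zero in p₀
... | i , pi , max | false = suc i , pi , λ { zero pz → ⊥-elim (true≢false pz p₀) ; (suc j) pj → max j pj }
... | i , pi , max | true with w zero ≤? w (suc i)
...   | yes w₀≤ = suc i , pi , λ { zero _ → w₀≤ ; (suc j) pj → max j pj }
...   | no w₀≰  = zero , p₀ , λ { zero _ → ≤-refl ; (suc j) pj → ≤-trans (max j pj) (<⇒≤ (≰⇒> w₀≰)) }

piece : ∀ {n} (X S : Fin n → Bool) (ℓ : Fin n → ℕ) → ℕ → Fin n → Bool
piece X S ℓ l x = X x ∧ (not (S x) ∧ does (ℓ x ≟ l))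

piece⁻ : ∀ {n} {X S : Fin n → Bool} {ℓ : Fin n → ℕ} {l} x →
         piece X S ℓ l x ≡ true → X x ≡ true × S x ≡ false × ℓ x ≡ l
piece⁻ {X = X} {S} {ℓ} {l} x e with X x | S x
... | true | false = refl , refl , does-true (ℓ x ≟ l) e

piece⁺ : ∀ {n} {X S : Fin n → Bool} {ℓ : Fin n → ℕ} {l} x →
         X x ≡ true → S x ≡ false → ℓ x ≡ l → piece X S ℓ l x ≡ true
piece⁺ {X = X} {S} {ℓ} x Xx Sx refl rewrite Xx | Sx = dec-true (ℓ x ≟ ℓ x) refl

module Descent {t : ℕ} (F : RootedForest t) where

  climb : ℕ → Fin t → Fin t
  climb zero    u = u
  climb (suc s) u = maybe′ (climb s) u (parent F u)

  climb-just : ∀ s {u w} → parent F u ≡ just w → climb (suc s) u ≡ climb s w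
  climb-just s e rewrite e = refl

  climb-root : ∀ s {u} → parent F u ≡ nothing → climb (suc s) u ≡ u
  climb-root s e rewrite e = refl

  climb-suc : ∀ s u → climb (suc s) u ≡ climb 1 (climb s u)
  climb-suc zero    u = refl
  climb-suc (suc s) u with parent F u in e
  ... | nothing rewrite e = refl
  ... | just w  = climb-suc s w

  1≤depth : ∀ u → 1 ≤ depth F u
  1≤depth u with parent F u in e
  ... | nothing = ≤-reflexive (sym (depthRoot F u e))
  ... | just w  = subst (1 ≤_) (sym (depthChild F u w e)) (s≤s z≤n)

  depth-climb : ∀ s u → s < depth F u → depth F (climb s u) ≡ depth F u ∸ s
  depth-climb zero    u _ = refl
  depth-climb (suc s) u s<d with parent F u in e
  ... | nothing = ⊥-elim (2≰1 (≤-trans s<d (≤-reflexive (depthRoot F u e))))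
    where 2≰1 : ¬ suc (suc s) ≤ 1
          2≰1 (s≤s ())
  ... | just w rewrite depthChild F u w e = depth-climb s w (≤-pred s<d)

  -- Below u i: u lies in the subtree rooted at i (possibly u ≡ i).
  Below : Fin t → Fin t → Set
  Below u i = climb (depth F u ∸ depth F i) u ≡ i

  below? : ∀ u i → Dec (Below u i)
  below? u i = climb (depth F u ∸ depth F i) u Finₚ.≟ i

  belowᵇ : Fin t → Fin t → Bool
  belowᵇ u i = does (below? u i)

  Below-refl : ∀ i → Below i i
  Below-refl i rewrite n∸n≡0 (depth F i) = refl

  Below⇒depth≤ : ∀ {u i} → Below u i → depth F i ≤ depth F u
  Below⇒depth≤ {u} {i} b with ≤-total (depth F i) (depth F u)
  ... | inj₁ i≤u = i≤u
  ... | inj₂ u≤i rewrite m≤n⇒m∸n≡0 u≤i = ≤-reflexive (cong (depth F) (sym b))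

  Below-step : ∀ {u w i} → parent F u ≡ just w → Below w i → Below u i
  Below-step {u} {w} {i} e b = begin
    climb (depth F u ∸ depth F i) u         ≡⟨ cong (λ d → climb (d ∸ depth F i) u) (depthChild F u w e) ⟩
    climb (suc (depth F w) ∸ depth F i) u   ≡⟨ cong (λ s → climb s u) (+-∸-assoc 1 (Below⇒depth≤ b)) ⟩
    climb (suc (depth F w ∸ depth F i)) u   ≡⟨ climb-just (depth F w ∸ depth F i) e ⟩
    climb (depth F w ∸ depth F i) w         ≡⟨ b ⟩
    i                                   ∎
    where open ≡-Reasoning

  Below-unique : ∀ {u c c′} → Below u c → Below u c′ → depth F c ≡ depth F c′ → c ≡ c′
  Below-unique {u} b b′ e = trans (sym b) (trans (cong (λ d → climb (depth F u ∸ d) u) e) b′)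

  Below-strict⇒depth< : ∀ {u i} → Below u i → u ≢ i → depth F i < depth F u
  Below-strict⇒depth< {u} {i} b u≢i with m≤n⇒m<n∨m≡n (Below⇒depth≤ b)
  ... | inj₁ i<u = i<u
  ... | inj₂ i≡u rewrite i≡u | n∸n≡0 (depth F u) = ⊥-elim (u≢i b)

  childToward : Fin t → Fin t → Fin t
  childToward i u = climb (depth F u ∸ suc (depth F i)) u

  module _ {u i} (b : Below u i) (u≢i : u ≢ i) where

    private
      i<u : depth F i < depth F u
      i<u = Below-strict⇒depth< b u≢i

      gap : ℕ
      gap = depth F u ∸ suc (depth F i)

      distance : depth F u ∸ depth F i ≡ suc gap
      distance = +-∸-assoc 1 i<u

      climb-suc-gap : climb (suc gap) u ≡ i
      climb-suc-gap = trans (cong (λ s → climb s u) (sym distance)) b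

      climb-childToward : climb 1 (childToward i u) ≡ i
      climb-childToward = trans (sym (climb-suc gap u)) climb-suc-gap

    depth-childToward : depth F (childToward i u) ≡ suc (depth F i)
    depth-childToward = trans (depth-climb gap u gap<u) (m∸[m∸n]≡n i<u)
      where
      gap<u : gap < depth F u
      gap<u = ≤-trans (≤-reflexive (sym distance)) (m∸n≤m (depth F u) (depth F i))

    Below-childToward : Below u (childToward i u)
    Below-childToward = cong (λ d → climb (depth F u ∸ d) u) depth-childToward

    parent-childToward : parent F (childToward i u) ≡ just i
    parent-childToward with parent F (childToward i u) in e
    ... | nothing = ⊥-elim (1+n≢n (trans (sym depth-childToward)
                                          (cong (depth F) (trans (sym (climb-root 0 e)) climb-childToward))))
    ... | just w  = cong just (trans (sym (climb-just 0 e)) climb-childToward)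

    Below-parent : ∃ λ w → parent F u ≡ just w × Below w i
    Below-parent with parent F u in e
    ... | nothing = ⊥-elim (u≢i (trans (sym (climb-root gap e)) climb-suc-gap))
    ... | just w  = w , refl , trans (sym (climb-just (depth F w ∸ depth F i) e)) (trans (cong (λ s → climb s u) one-more) b)
      where
      i≤w : depth F i ≤ depth F w
      i≤w = ≤-pred (subst (depth F i <_) (depthChild F u w e) i<u)
      one-more : suc (depth F w ∸ depth F i) ≡ depth F u ∸ depth F i
      one-more = trans (sym (+-∸-assoc 1 i≤w)) (cong (_∸ depth F i) (sym (depthChild F u w e)))

  Below-root : ∀ r → (∀ u → parent F u ≡ nothing → u ≡ r) → ∀ u → Below u r
  Below-root r root-unique u = go (depth F u) u ≤-refl
    where
    go : ∀ b u → depth F u ≤ b → Below u r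
    go b u d≤b with parent F u in e
    ... | nothing rewrite root-unique u e = Below-refl r
    go zero    u d≤b | just w = ⊥-elim (<-irrefl refl (≤-trans (1≤depth u) d≤b))
    go (suc b) u d≤b | just w = Below-step e (go b w (≤-pred (subst (_≤ suc b) (depthChild F u w e) d≤b)))

record Rooting {t : ℕ} (T : FinGraph t) : Set where
  field
    forest      : RootedForest t
    root        : Fin t
    root-unique : ∀ u → parent forest u ≡ nothing → u ≡ root
    edge-parent : ∀ {a b} → adj T a b → parent forest a ≡ just b ⊎ parent forest b ≡ just a

module TreeRooting {t : ℕ} (T : FinGraph t) where

  open import Data.Vec.Membership.Propositional {A = Fin t} using () renaming (_∈_ to _∈ᵥ_; _∉_ to _∉ᵥ_)
  open import Data.Vec.Membership.Propositional.Properties using (∈-lookup)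
  open import Data.Vec.Membership.DecPropositional (Finₚ._≟_ {t}) using (_∈?_)
  open import Data.Vec.Relation.Unary.Any using (here; there)

  -- vertices p lists the vertices of p from its end back to its origin s.
  mutual
    data SimplePath (s : Fin t) : ℕ → Fin t → Set where
      start : SimplePath s 0 s
      step  : ∀ {k u v} (p : SimplePath s k u) → adj T u v → v ∉ᵥ vertices p → SimplePath s (suc k) v

    vertices : ∀ {s k u} → SimplePath s k u → Vec (Fin t) (suc k)
    vertices {s} start            = s ∷ []
    vertices (step {v = v} p _ _) = v ∷ vertices p

  origin∈ : ∀ {s k u} (p : SimplePath s k u) → s ∈ᵥ vertices p
  origin∈ start        = here refl
  origin∈ (step p _ _) = there (origin∈ p)

  end∈ : ∀ {s k u} (p : SimplePath s k u) → u ∈ᵥ vertices p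
  end∈ start        = here refl
  end∈ (step p _ _) = here refl

  lookup-vertices-injective : ∀ {s k u} (p : SimplePath s k u) i j →
                              lookup (vertices p) i ≡ lookup (vertices p) j → i ≡ j
  lookup-vertices-injective start        zero    zero    _ = refl
  lookup-vertices-injective (step p _ _) zero    zero    _ = refl
  lookup-vertices-injective (step p _ v∉) zero    (suc j) e =
    ⊥-elim (v∉ (subst (_∈ᵥ vertices p) (sym e) (∈-lookup j (vertices p))))
  lookup-vertices-injective (step p _ v∉) (suc i) zero    e =
    ⊥-elim (v∉ (subst (_∈ᵥ vertices p) e (∈-lookup i (vertices p))))
  lookup-vertices-injective (step p _ _) (suc i) (suc j) e = cong suc (lookup-vertices-injective p i j e)

  lookup-vertices-adj : ∀ {s k u} (p : SimplePath s k u) (i : Fin k) →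
                        adj T (lookup (vertices p) (inject₁ i)) (lookup (vertices p) (suc i))
  lookup-vertices-adj (step start e _)            zero    = adjSym T e
  lookup-vertices-adj (step (step p _ _) e _)     zero    = adjSym T e
  lookup-vertices-adj (step p _ _)                (suc i) = lookup-vertices-adj p i

  lookup-vertices-last : ∀ {s k u} (p : SimplePath s k u) → lookup (vertices p) (fromℕ k) ≡ s
  lookup-vertices-last start        = refl
  lookup-vertices-last (step p _ _) = lookup-vertices-last p

  closing-cycle : ∀ {s l a} (p : SimplePath s (suc (suc l)) a) → adj T a s → HasCycle T
  closing-cycle {s} {l} p@(step _ _ _) e =
    l , lookup (vertices p) , (λ {i} {j} → lookup-vertices-injective p i j) , lookup-vertices-adj p ,
    subst (λ z → adj T z (lookup (vertices p) zero)) (sym (lookup-vertices-last p)) (adjSym T e)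

  truncate : ∀ {s k u y} (p : SimplePath s k u) → y ∈ᵥ vertices p → Σ ℕ λ k′ → SimplePath s k′ y
  truncate start              (here refl) = 0 , start
  truncate p@(step _ _ _)     (here refl) = _ , p
  truncate (step p _ _)       (there y∈)  = truncate p y∈

  extend : ∀ {s k u v} (p : SimplePath s k u) → adj T u v → Σ ℕ λ k′ → SimplePath s k′ v
  extend {v = v} p e with v ∈? vertices p
  ... | yes v∈ = truncate p v∈
  ... | no  v∉ = _ , step p e v∉

  loop-erase : ∀ {s k u v} (p : SimplePath s k u) → Star (adj T) u v → Σ ℕ λ k′ → SimplePath s k′ v
  loop-erase p ε       = _ , p
  loop-erase p (e ◅ w) = loop-erase (proj₂ (extend p e)) w

  secondVertex : ∀ {s k u} → SimplePath s k u → Maybe (Fin t)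
  secondVertex start                      = nothing
  secondVertex (step {v = v} start _ _)   = just v
  secondVertex (step p@(step _ _ _) _ _)  = secondVertex p

  secondVertex-step : ∀ {s k u v b} (p : SimplePath s k u) (e : adj T u v) (v∉ : v ∉ᵥ vertices p) →
                      secondVertex p ≡ just b → secondVertex (step p e v∉) ≡ just b
  secondVertex-step (step _ _ _) _ _ sb = sb

  secondVertex-truncate : ∀ {s k u y b} (p : SimplePath s k u) (y∈ : y ∈ᵥ vertices p) → y ≢ s →
                          secondVertex p ≡ just b → secondVertex (proj₂ (truncate p y∈)) ≡ just b
  secondVertex-truncate (step _ _ _)            (here refl)         _   sb = sb
  secondVertex-truncate (step start _ _)        (there (here refl)) y≢s _  = ⊥-elim (y≢s refl)
  secondVertex-truncate (step p@(step _ _ _) _ _) (there y∈)        y≢s sb = secondVertex-truncate p y∈ y≢s sb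

  Avoiding : Fin t → Fin t → Fin t → Set
  Avoiding u x y = adj T x y × y ≢ u

  loop-erase-avoiding : ∀ {u k x y b} (p : SimplePath u k x) → secondVertex p ≡ just b → Star (Avoiding u) x y →
                        Σ ℕ λ k′ → Σ (SimplePath u k′ y) λ q → secondVertex q ≡ just b
  loop-erase-avoiding p sb ε = _ , p , sb
  loop-erase-avoiding p sb (_◅_ {j = y} (e , y≢u) w) with y ∈? vertices p
  ... | yes y∈ = loop-erase-avoiding (proj₂ (truncate p y∈)) (secondVertex-truncate p y∈ y≢u sb) w
  ... | no  y∉ = loop-erase-avoiding (step p e y∉) (secondVertex-step p e y∉ sb) w

  walk-avoiding : ∀ {u s k x} (p : SimplePath s k x) → u ∉ᵥ vertices p → Star (Avoiding u) s x
  walk-avoiding start        _  = ε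
  walk-avoiding (step p e _) u∉ = walk-avoiding p (u∉ ∘ there) ◅◅ ((e , λ v≡u → u∉ (here (sym v≡u))) ◅ ε)

  walk-avoiding-reverse : ∀ {u s k x} (p : SimplePath s k x) → u ∉ᵥ vertices p → Star (Avoiding u) x s
  walk-avoiding-reverse start        _  = ε
  walk-avoiding-reverse (step p e _) u∉ =
    (adjSym T e , (λ w≡u → u∉ (there (subst (_∈ᵥ vertices p) w≡u (end∈ p)))))
      ◅ walk-avoiding-reverse p (u∉ ∘ there)

  segment : ∀ {s k x y} (p : SimplePath s k x) → y ∈ᵥ vertices p →
            Σ ℕ λ k′ → Σ (SimplePath y k′ x) λ q → ∀ {z} → z ∈ᵥ vertices q → z ∈ᵥ vertices p
  segment start        (here refl) = 0 , start , λ z∈ → z∈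
  segment (step p e _) (here refl) = 0 , start , λ { (here refl) → here refl }
  segment (step p e v∉) (there y∈) with segment p y∈
  ... | k′ , q , q⊆p =
    suc k′ , step q e (v∉ ∘ q⊆p) , λ { (here z≡v) → here z≡v ; (there z∈) → there (q⊆p z∈) }

  predecessor : ∀ {s k u} → SimplePath s k u → Maybe (Fin t)
  predecessor start                = nothing
  predecessor (step {u = w} _ _ _) = just w

  module _ (connected : Connected T) (acyclic : ¬ HasCycle T) (r : Fin t) where

    -- Paths r ⋯ a–u and r ⋯ b–u with a ≢ b give a walk u–b ⋯ r ⋯ a avoiding u;
    -- erasing its loops closes a cycle a–u–b ⋯ a.
    predecessor-unique : ∀ {k k′ u} (p : SimplePath r k u) (q : SimplePath r k′ u) → predecessor p ≡ predecessor q
    predecessor-unique start        start         = refl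
    predecessor-unique start        (step q _ r∉) = ⊥-elim (r∉ (origin∈ q))
    predecessor-unique (step p _ r∉) start        = ⊥-elim (r∉ (origin∈ p))
    predecessor-unique {u = u} (step {u = a} p e u∉p) (step {u = b} q e′ u∉q) with a Finₚ.≟ b
    ... | yes refl = refl
    ... | no a≢b with loop-erase-avoiding (step start (adjSym T e′) b∉[u]) refl
                        (walk-avoiding-reverse q u∉q ◅◅ walk-avoiding p u∉p)
      where
      b∉[u] : b ∉ᵥ u ∷ []
      b∉[u] (here refl) = adjIrr T e′
    ...   | _ , start , ()
    ...   | _ , step start _ _ , refl = ⊥-elim (a≢b refl)
    ...   | _ , c@(step (step _ _ _) _ _) , _ = ⊥-elim (acyclic (closing-cycle c e))

    length-unique : ∀ {k k′ u} (p : SimplePath r k u) (q : SimplePath r k′ u) → k ≡ k′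
    length-unique start         start         = refl
    length-unique start         (step q _ r∉) = ⊥-elim (r∉ (origin∈ q))
    length-unique (step p _ r∉) start         = ⊥-elim (r∉ (origin∈ p))
    length-unique p@(step p′ _ _) q@(step q′ _ _) with predecessor-unique p q
    ... | refl = cong suc (length-unique p′ q′)

    -- If b lies on the path to a without preceding a, that path from b to a and the edge a–b form a cycle.
    tree-edge : ∀ {k k′ a b} (p : SimplePath r k a) (q : SimplePath r k′ b) → adj T a b →
                predecessor p ≡ just b ⊎ predecessor q ≡ just a
    tree-edge {b = b} p q e with b ∈? vertices p
    ... | no b∉ = inj₂ (predecessor-unique q (step p e b∉))
    tree-edge start q e | yes (here refl) = ⊥-elim (adjIrr T e)
    tree-edge (step p _ _) q e | yes (here refl) = ⊥-elim (adjIrr T e)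
    tree-edge {a = a} {b} (step {u = z} p e′ a∉p) q e | yes (there b∈p) with b Finₚ.≟ z
    ... | yes refl = inj₁ refl
    ... | no b≢z with segment p b∈p
    ...   | _ , start , _ = ⊥-elim (b≢z refl)
    ...   | _ , c@(step _ _ _) , c⊆p = ⊥-elim (acyclic (closing-cycle (step c e′ (a∉p ∘ c⊆p)) e))

    pathFromRoot : ∀ u → Σ ℕ λ k → SimplePath r k u
    pathFromRoot u = loop-erase start (connected r u)

    forest : RootedForest t
    forest = record
      { parent     = λ u → predecessor (proj₂ (pathFromRoot u))
      ; depth      = λ u → suc (proj₁ (pathFromRoot u))
      ; depthRoot  = λ u → depth-root (proj₂ (pathFromRoot u))
      ; depthChild = λ u w → depth-child (proj₂ (pathFromRoot u)) }
      where
      depth-root : ∀ {k u} (p : SimplePath r k u) → predecessor p ≡ nothing → suc k ≡ 1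
      depth-root start _ = refl
      depth-child : ∀ {k u w} (p : SimplePath r k u) → predecessor p ≡ just w →
                    suc k ≡ suc (suc (proj₁ (pathFromRoot w)))
      depth-child (step p _ _) refl = cong (2 +_) (length-unique p (proj₂ (pathFromRoot _)))

    rooting : Rooting T
    rooting = record
      { forest      = forest
      ; root        = r
      ; root-unique = λ u → root-unique (proj₂ (pathFromRoot u))
      ; edge-parent = λ {a} {b} e → tree-edge (proj₂ (pathFromRoot a)) (proj₂ (pathFromRoot b)) e }
      where
      root-unique : ∀ {k u} (p : SimplePath r k u) → predecessor p ≡ nothing → u ≡ r
      root-unique start _ = refl

-- The separator is a union of `bags` bags of a tree decomposition, each charged to more than t vertices of X.
record Separation {n : ℕ} (G : FinGraph n) (k : ℕ) (X : Fin n → Bool) (t : ℕ) : Set where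
  field
    separator      : Fin n → Bool
    label          : Fin n → ℕ
    bags           : ℕ
    separator⊆     : ∀ x → separator x ≡ true → X x ≡ true
    separator-size : count separator ≤ suc k * bags
    bags-bound     : bags * suc t ≤ count X
    edge-label     : ∀ x y → X x ≡ true → X y ≡ true → separator x ≡ false → separator y ≡ false →
                     adj G x y → label x ≡ label y
    piece-size     : ∀ l → count (piece X separator label l) ≤ t

trivial-separation : ∀ {n} (G : FinGraph n) k (X : Fin n → Bool) t → count X ≤ t → Separation G k X t
trivial-separation {n} G k X t |X|≤t = record
  { separator      = λ _ → false
  ; label          = λ _ → 0
  ; bags           = 0
  ; separator⊆     = λ _ ()
  ; separator-size = ≤-reflexive (trans (count-none {n} _ (λ _ → refl)) (sym (*-zeroʳ (suc k))))
  ; bags-bound     = z≤n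
  ; edge-label     = λ _ _ _ _ _ _ _ → refl
  ; piece-size     = λ l → ≤-trans (count-mono _ X (λ x e → ∧-conicalˡ (X x) _ e)) |X|≤t }

module Separator {n : ℕ} {G : FinGraph n} {k : ℕ} (D : TreeDecomposition G k) (R : Rooting (TreeDecomposition.T D)) where

  open TreeDecomposition D
  open Rooting R
  open Descent forest

  inBag : Fin t → Fin n → Bool
  inBag i x = lookup (bag i) x

  inBag-count : ∀ i → count (inBag i) ≤ suc k
  inBag-count i = subst (_≤ suc k) (sym (count-lookup (bag i))) (bagSize i)

  -- The bags containing x form a subtree of T, so a path between them leaving the subtree of c
  -- uses the edge from c to its parent.
  exit-subtree : ∀ {x a b c} → inBag a x ≡ true → Below a c → inBag b x ≡ true → ¬ Below b c →
                 inBag c x ≡ true × ∃ λ w → parent forest c ≡ just w × inBag w x ≡ true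
  exit-subtree {x} {a} {b} {c} xa a≤c xb b≰c = go (subtree x (lookup⇒[]= x (bag a) xa) (lookup⇒[]= x (bag b) xb)) a≤c
    where
    go : ∀ {a′} → Star (λ u v → adj T u v × (x ∈ bag u × x ∈ bag v)) a′ b → Below a′ c →
         inBag c x ≡ true × ∃ λ w → parent forest c ≡ just w × inBag w x ≡ true
    go ε a′≤c = ⊥-elim (b≰c a′≤c)
    go {a′} (_◅_ {j = v} (e , x∈a′ , x∈v) rest) a′≤c with below? v c
    ... | yes v≤c = go rest v≤c
    ... | no v≰c with edge-parent e
    ...   | inj₂ v→a′ = ⊥-elim (v≰c (Below-step v→a′ a′≤c))
    ...   | inj₁ a′→v with a′ Finₚ.≟ c
    ...     | yes refl = []=⇒lookup x∈a′ , v , a′→v , []=⇒lookup x∈v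
    ...     | no a′≢c with Below-parent a′≤c a′≢c
    ...       | w , a′→w , w≤c with just-injective (trans (sym a′→v) a′→w)
    ...         | refl = ⊥-elim (v≰c w≤c)

  inSubtree : Fin t → Fin n → Bool
  inSubtree c x = anyᵇ (λ j → belowᵇ j c ∧ inBag j x)

  inSubtree-intro : ∀ {c x} j → Below j c → inBag j x ≡ true → inSubtree c x ≡ true
  inSubtree-intro {c} {x} j j≤c xj = dec-true (anyTrue? _) (j , ∧-intro (dec-true (below? j c) j≤c) xj)

  weight : (Fin n → Bool) → Fin t → ℕ
  weight X c = count (λ x → X x ∧ inSubtree c x)

  weight-root : ∀ X → count X ≤ weight X root
  weight-root X = count-mono X _ (λ x e → ∧-intro e (in-root x))
    where
    in-root : ∀ x → inSubtree root x ≡ true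
    in-root x with covV x
    ... | j , x∈j = inSubtree-intro j (Below-root root root-unique j) ([]=⇒lookup x∈j)

  heavy-node : ∀ X s → s < count X →
               ∃ λ i → s < weight X i × (∀ c → parent forest c ≡ just i → weight X c ≤ s)
  heavy-node X s s<X with maximiser (λ c → does (s <? weight X c)) (depth forest) root
                             (dec-true (s <? weight X root) (<-≤-trans s<X (weight-root X)))
  ... | i , heavy , deepest = i , does-true (s <? weight X i) heavy , light
    where
    light : ∀ c → parent forest c ≡ just i → weight X c ≤ s
    light c c→i with s <? weight X c
    ... | yes s<c = ⊥-elim (1+n≰n (≤-trans (≤-reflexive (sym (depthChild forest c i c→i)))
                                           (deepest c (dec-true (s <? weight X c) s<c))))
    ... | no  s≮c = ≮⇒≥ s≮c

  module Cut (X : Fin n → Bool) (s : ℕ) (i : Fin t) (heavy : s < weight X i)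
             (light : ∀ c → parent forest c ≡ just i → weight X c ≤ s) where

    outside : Fin n → Bool
    outside x = X x ∧ not (inSubtree i x)

    outside-intro : ∀ {x} → X x ≡ true → inSubtree i x ≡ false → outside x ≡ true
    outside-intro Xx x∉ rewrite Xx | x∉ = refl

    count-outside : count X ≡ weight X i + count outside
    count-outside = count-split X (inSubtree i)

    outside<X : count outside < count X
    outside<X = ≤-trans (+-monoˡ-≤ (count outside) (≤-trans (s≤s z≤n) heavy)) (≤-reflexive (sym count-outside))

    bagBelow : Fin n → Fin t
    bagBelow x = choose (λ j → belowᵇ j i ∧ inBag j x) i

    bagBelow-spec : ∀ {x} → inSubtree i x ≡ true → Below (bagBelow x) i × inBag (bagBelow x) x ≡ true
    bagBelow-spec {x} e with choose-true (λ j → belowᵇ j i ∧ inBag j x) i e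
    ... | e′ = does-true (below? (bagBelow x) i) (∧-conicalˡ _ _ e′) , ∧-conicalʳ (belowᵇ (bagBelow x) i) _ e′

    branch : Fin n → Fin t
    branch x = childToward i (bagBelow x)

    bag≢i : ∀ {z j} → inBag i z ≡ false → inBag j z ≡ true → j ≢ i
    bag≢i z∉i z∈j refl = true≢false z∈j z∉i

    branch-Below : ∀ {x} → inBag i x ≡ false → inSubtree i x ≡ true → Below (bagBelow x) (branch x)
    branch-Below x∉i x∈ = Below-childToward (proj₁ (bagBelow-spec x∈)) (bag≢i x∉i (proj₂ (bagBelow-spec x∈)))

    parent-branch : ∀ {x} → inBag i x ≡ false → inSubtree i x ≡ true → parent forest (branch x) ≡ just i
    parent-branch x∉i x∈ = parent-childToward (proj₁ (bagBelow-spec x∈)) (bag≢i x∉i (proj₂ (bagBelow-spec x∈)))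

    depth-branch : ∀ {x} → inBag i x ≡ false → inSubtree i x ≡ true → depth forest (branch x) ≡ suc (depth forest i)
    depth-branch x∉i x∈ = depth-childToward (proj₁ (bagBelow-spec x∈)) (bag≢i x∉i (proj₂ (bagBelow-spec x∈)))

    bag-Below-i : ∀ {z j} → inBag i z ≡ false → inSubtree i z ≡ true → inBag j z ≡ true → Below j i
    bag-Below-i {z} {j} z∉i z∈ z∈j with below? j i
    ... | yes j≤i = j≤i
    ... | no  j≰i with exit-subtree (proj₂ (bagBelow-spec z∈)) (proj₁ (bagBelow-spec z∈)) z∈j j≰i
    ...   | z∈i , _ = ⊥-elim (true≢false z∈i z∉i)

    bag-Below-branch : ∀ {z j} → inBag i z ≡ false → inSubtree i z ≡ true → inBag j z ≡ true → Below j (branch z)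
    bag-Below-branch {z} {j} z∉i z∈ z∈j with below? j (branch z)
    ... | yes j≤b = j≤b
    ... | no  j≰b with exit-subtree (proj₂ (bagBelow-spec z∈)) (branch-Below z∉i z∈) z∈j j≰b
    ...   | _ , w , b→w , z∈w with just-injective (trans (sym (parent-branch z∉i z∈)) b→w)
    ...     | refl = ⊥-elim (true≢false z∈w z∉i)

    branch-unique : ∀ {x y j} → inBag i x ≡ false → inSubtree i x ≡ true →
                    inBag i y ≡ false → inSubtree i y ≡ true →
                    inBag j x ≡ true → inBag j y ≡ true → branch x ≡ branch y
    branch-unique {x} {y} x∉i x∈ y∉i y∈ x∈j y∈j =
      Below-unique (bag-Below-branch x∉i x∈ x∈j) (bag-Below-branch y∉i y∈ y∈j)
        (trans (depth-branch x∉i x∈) (sym (depth-branch y∉i y∈)))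

    -- Separate the subtree of i by bag i, and the rest by a separation of outside.
    extend : Separation G k outside s → Separation G k X s
    extend rest = record
      { separator      = separator
      ; label          = label
      ; bags           = suc R.bags
      ; separator⊆     = separator⊆
      ; separator-size = separator-size
      ; bags-bound     = subst (suc R.bags * suc s ≤_) (sym count-outside) (+-mono-≤ heavy R.bags-bound)
      ; edge-label     = edge-label
      ; piece-size     = piece-size }
      where
      module R = Separation rest

      separator : Fin n → Bool
      separator x = (X x ∧ inBag i x) ∨ R.separator x

      -- Labels below t (the number of tree nodes) name a child of i; the others are labels of rest shifted by t.
      label : Fin n → ℕ
      label x = if inSubtree i x then toℕ (branch x) else t + R.label x

      label-inside : ∀ {x} → inSubtree i x ≡ true → label x ≡ toℕ (branch x)
      label-inside e rewrite e = refl

      label-outside : ∀ {x} → inSubtree i x ≡ false → label x ≡ t + R.label x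
      label-outside e rewrite e = refl

      label-side : ∀ {x y} → inSubtree i x ≡ true → inSubtree i y ≡ false → label x ≢ label y
      label-side {x} {y} x∈ y∉ e = <⇒≱ (Finₚ.toℕ<n (branch x))
        (≤-trans (m≤m+n t (R.label y)) (≤-reflexive (trans (sym (label-outside y∉)) (trans (sym e) (label-inside x∈)))))

      not-separator : ∀ {x} → X x ≡ true → separator x ≡ false → inBag i x ≡ false × R.separator x ≡ false
      not-separator {x} Xx e rewrite Xx = ∨-conicalˡ (inBag i x) _ e , ∨-conicalʳ (inBag i x) _ e

      separator⊆ : ∀ x → separator x ≡ true → X x ≡ true
      separator⊆ x e with X x in Xx
      ... | true  = refl
      ... | false = ⊥-elim (true≢false (∧-conicalˡ (X x) _ (R.separator⊆ x e)) Xx)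

      separator-size : count separator ≤ suc k * suc R.bags
      separator-size = begin
        count separator                                           ≤⟨ count-∨ _ R.separator ⟩
        count (λ x → X x ∧ inBag i x) + count R.separator          ≤⟨ +-mono-≤ bag-part R.separator-size ⟩
        suc k + suc k * R.bags                                    ≡⟨ sym (*-suc (suc k) R.bags) ⟩
        suc k * suc R.bags                                        ∎
        where
        open ≤-Reasoning
        bag-part : count (λ x → X x ∧ inBag i x) ≤ suc k
        bag-part = ≤-trans (count-mono _ (inBag i) (λ x e → ∧-conicalʳ (X x) _ e)) (inBag-count i)

      edge-label : ∀ x y → X x ≡ true → X y ≡ true → separator x ≡ false → separator y ≡ false →
                   adj G x y → label x ≡ label y
      edge-label x y Xx Xy Sx Sy xy with covE xy | not-separator Xx Sx | not-separator Xy Sy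
                                      | true⊎false (inSubtree i x) | true⊎false (inSubtree i y)
      ... | j , x∈j , y∈j | x∉i , _ | y∉i , _ | inj₁ x? | inj₁ y? =
        trans (label-inside x?) (trans (cong toℕ (branch-unique x∉i x? y∉i y? ([]=⇒lookup x∈j) ([]=⇒lookup y∈j)))
                                       (sym (label-inside y?)))
      ... | j , x∈j , y∈j | x∉i , _ | _ | inj₁ x? | inj₂ y? =
        ⊥-elim (true≢false (inSubtree-intro j (bag-Below-i x∉i x? ([]=⇒lookup x∈j)) ([]=⇒lookup y∈j)) y?)
      ... | j , x∈j , y∈j | _ | y∉i , _ | inj₂ x? | inj₁ y? =
        ⊥-elim (true≢false (inSubtree-intro j (bag-Below-i y∉i y? ([]=⇒lookup y∈j)) ([]=⇒lookup x∈j)) x?)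
      ... | _ | _ , Sx′ | _ , Sy′ | inj₂ x? | inj₂ y? =
        trans (label-outside x?) (trans (cong (t +_) (R.edge-label x y (outside-intro Xx x?) (outside-intro Xy y?) Sx′ Sy′ xy))
                                        (sym (label-outside y?)))

      piece-size : ∀ l → count (piece X separator label l) ≤ s
      piece-size l with anyTrue? (piece X separator label l)
      ... | no none = ≤-trans (≤-reflexive (count-none _ (noneTrue _ none))) z≤n
      ... | yes (x₀ , x₀∈) with piece⁻ {X = X} {separator} {label} x₀ x₀∈ | true⊎false (inSubtree i x₀)
      ...   | Xx₀ , Sx₀ , lx₀ | inj₁ x₀? =
                ≤-trans (count-mono _ _ inside) (light (branch x₀) (parent-branch (proj₁ (not-separator Xx₀ Sx₀)) x₀?))
        where
        inside : ∀ x → piece X separator label l x ≡ true → X x ∧ inSubtree (branch x₀) x ≡ true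
        inside x e with piece⁻ {X = X} {separator} {label} x e | true⊎false (inSubtree i x)
        ... | Xx , Sx , lx | inj₁ x? = ∧-intro Xx (inSubtree-intro (bagBelow x) same-branch (proj₂ (bagBelow-spec x?)))
          where
          same-branch : Below (bagBelow x) (branch x₀)
          same-branch = subst (Below (bagBelow x))
            (Finₚ.toℕ-injective (trans (sym (label-inside x?)) (trans lx (trans (sym lx₀) (label-inside x₀?)))))
            (branch-Below (proj₁ (not-separator Xx Sx)) x?)
        ... | _ , _ , lx | inj₂ x? = ⊥-elim (label-side x₀? x? (trans lx₀ (sym lx)))
      ...   | Xx₀ , Sx₀ , lx₀ | inj₂ x₀? = ≤-trans (count-mono _ _ outer) (R.piece-size (R.label x₀))
        where
        outer : ∀ x → piece X separator label l x ≡ true → piece outside R.separator R.label (R.label x₀) x ≡ true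
        outer x e with piece⁻ {X = X} {separator} {label} x e | true⊎false (inSubtree i x)
        ... | _ , _ , lx | inj₁ x? = ⊥-elim (label-side x? x₀? (trans lx (sym lx₀)))
        ... | Xx , Sx , lx | inj₂ x? =
          piece⁺ {X = outside} {R.separator} {R.label} x (outside-intro Xx x?) (proj₂ (not-separator Xx Sx))
          (+-cancelˡ-≡ t _ _ (trans (sym (label-outside x?)) (trans lx (trans (sym lx₀) (label-outside x₀?)))))

  separate : ∀ X s → Separation G k X s
  separate X s = go (count X) X ≤-refl
    where
    go : ∀ fuel X → count X ≤ fuel → Separation G k X s
    go fuel X X≤fuel with count X ≤? s
    ... | yes X≤s = trivial-separation G k X s X≤s
    go zero X X≤0 | no X≰s = ⊥-elim (X≰s (≤-trans X≤0 z≤n))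
    go (suc fuel) X X≤fuel | no X≰s with heavy-node X s (≰⇒> X≰s)
    ... | i , heavy , light = Cut.extend X s i heavy light
            (go fuel (Cut.outside X s i heavy light) (≤-pred (≤-trans (Cut.outside<X X s i heavy light) X≤fuel)))

separation : ∀ {n} {G : FinGraph n} {k} → TreewidthAtMost G k → ∀ X s → Separation G k X s
separation {G = G} {k} D X s with count X ≤? s | anyTrue? X
... | yes X≤s | _ = trivial-separation G k X s X≤s
... | no X≰s | no none = ⊥-elim (X≰s (≤-trans (≤-reflexive (count-none X (noneTrue X none))) z≤n))
... | no _ | yes (x , _) = Separator.separate D (TreeRooting.rooting T (proj₁ isTree) (proj₂ isTree) (proj₁ (covV x))) X s
  where open TreeDecomposition D

AncestorVia : ∀ {n} → (Fin n → Maybe (Fin n)) → Fin n → Fin n → Set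
AncestorVia up a b = TransClosure (λ a b → up b ≡ just a) a b

module _ {n : ℕ} (G : FinGraph n) (m : ℕ) where

  -- A layout of G[X] into (closure of a forest of height ≤ d) ⊠ K_m: x ↦ (node x, colour x), where the
  -- forest is given by up and level on Fin n and only its part inside X is constrained.
  record Layout (X : Fin n → Bool) (d : ℕ) : Set where
    field
      node         : Fin n → Fin n
      colour       : Fin n → ℕ
      up           : Fin n → Maybe (Fin n)
      level        : Fin n → ℕ
      node∈        : ∀ x → X x ≡ true → X (node x) ≡ true
      colour<      : ∀ x → X x ≡ true → colour x < m
      injective    : ∀ x y → X x ≡ true → X y ≡ true → node x ≡ node y → colour x ≡ colour y → x ≡ y
      edge         : ∀ x y → X x ≡ true → X y ≡ true → adj G x y →
                     node x ≡ node y ⊎ (AncestorVia up (node x) (node y) ⊎ AncestorVia up (node y) (node x))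
      up∈          : ∀ u w → X u ≡ true → up u ≡ just w → X w ≡ true
      level-root   : ∀ u → X u ≡ true → up u ≡ nothing → level u ≡ 1
      level-child  : ∀ u w → X u ≡ true → up u ≡ just w → level u ≡ suc (level w)
      level≤       : ∀ u → X u ≡ true → level u ≤ d

  empty-layout : ∀ (X : Fin n → Bool) d → (∀ x → X x ≡ false) → Layout X d
  empty-layout X d none = record
    { node = id ; colour = λ _ → 0 ; up = λ _ → nothing ; level = λ _ → 1
    ; node∈ = λ x e → absurd e ; colour< = λ x e → absurd e
    ; injective = λ x _ e → absurd e ; edge = λ x _ e → absurd e ; up∈ = λ u _ e → absurd e
    ; level-root = λ u e → absurd e ; level-child = λ u _ e → absurd e ; level≤ = λ u e → absurd e }
    where
    absurd : ∀ {A : Set} {x} → X x ≡ true → A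
    absurd {x = x} e = ⊥-elim (true≢false e (none x))

  module _ {X : Fin n → Bool} {d : ℕ} (L : Layout X d) where

    open Layout L

    root-above : ∀ u → X u ≡ true → ∃ λ ρ → X ρ ≡ true × up ρ ≡ nothing × (ρ ≡ u ⊎ AncestorVia up ρ u)
    root-above u Xu = go (level u) u ≤-refl Xu
      where
      go : ∀ b u → level u ≤ b → X u ≡ true →
           ∃ λ ρ → X ρ ≡ true × up ρ ≡ nothing × (ρ ≡ u ⊎ AncestorVia up ρ u)
      go b u u≤b Xu with up u in e
      ... | nothing = u , Xu , e , inj₁ refl
      go zero    u u≤b Xu | just w =
        ⊥-elim (1+n≰n (≤-trans (≤-reflexive (sym (level-child u w Xu e))) (≤-trans u≤b z≤n)))
      go (suc b) u u≤b Xu | just w with go b w (≤-pred (subst (_≤ suc b) (level-child u w Xu e) u≤b)) (up∈ u w Xu e)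
      ... | ρ , Xρ , ρ-root , inj₁ refl = ρ , Xρ , ρ-root , inj₂ [ e ]
      ... | ρ , Xρ , ρ-root , inj₂ ρ<w  = ρ , Xρ , ρ-root , inj₂ (ρ<w ∷ʳ e)

  centre : (S : Fin n → Bool) →
           ∃ λ c → (∀ s → c ≡ just s → S s ≡ true) × (c ≡ nothing → ∀ x → S x ≡ false)
  centre S with anyTrue? S
  ... | yes (s , Ss) = just s , (λ { _ refl → Ss }) , (λ ())
  ... | no none      = nothing , (λ _ ()) , (λ _ → noneTrue S none)

  -- S goes to the new root c, coloured by rank, and the layouts of the pieces of X \ S hang below c.
  module Combine (X S : Fin n → Bool) (ℓ : Fin n → ℕ) (j : ℕ)
    (S⊆X : ∀ x → S x ≡ true → X x ≡ true) (|S|≤m : count S ≤ m)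
    (edge-label : ∀ x y → X x ≡ true → X y ≡ true → S x ≡ false → S y ≡ false → adj G x y → ℓ x ≡ ℓ y)
    (c : Maybe (Fin n)) (c∈S : ∀ s → c ≡ just s → S s ≡ true) (c-none : c ≡ nothing → ∀ x → S x ≡ false)
    (sub : (l : ℕ) → Layout (piece X S ℓ l) j) where

    private
      module Sub (l : ℕ) = Layout (sub l)

      P : ℕ → Fin n → Bool
      P = piece X S ℓ

      P⁻ : ∀ {l} x → P l x ≡ true → X x ≡ true × S x ≡ false × ℓ x ≡ l
      P⁻ = piece⁻ {X = X} {S} {ℓ}

      P⁺ : ∀ {x} → X x ≡ true → S x ≡ false → P (ℓ x) x ≡ true
      P⁺ {x} Xx Sx = piece⁺ {X = X} {S} {ℓ} x Xx Sx refl

      P-relabel : ∀ {x l} → X x ≡ true → S x ≡ false → ℓ x ≡ l → P l x ≡ true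
      P-relabel {x} Xx Sx e = piece⁺ {X = X} {S} {ℓ} x Xx Sx e

    shift : ℕ
    shift = maybe′ (λ _ → 1) 0 c

    node : Fin n → Fin n
    node x = if S x then fromMaybe x c else Sub.node (ℓ x) x

    colour : Fin n → ℕ
    colour x = if S x then rank S x else Sub.colour (ℓ x) x

    up : Fin n → Maybe (Fin n)
    up u = if S u then nothing else (Sub.up (ℓ u) u <∣> c)

    level : Fin n → ℕ
    level u = if S u then 1 else Sub.level (ℓ u) u + shift

    c-just : ∀ {x} → S x ≡ true → c ≡ just (fromMaybe x c)
    c-just {x} Sx = go c refl
      where
      go : ∀ c′ → c ≡ c′ → c′ ≡ just (fromMaybe x c′)
      go (just _) _ = refl
      go nothing  e = ⊥-elim (true≢false Sx (c-none e x))

    shift≤1 : shift ≤ 1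
    shift≤1 = go c
      where
      go : ∀ c′ → maybe′ (λ _ → 1) 0 c′ ≤ 1
      go (just _) = ≤-refl
      go nothing  = z≤n

    sub-node∈ : ∀ {x} → X x ≡ true → S x ≡ false → P (ℓ x) (Sub.node (ℓ x) x) ≡ true
    sub-node∈ Xx Sx = Sub.node∈ _ _ (P⁺ Xx Sx)

    up-piece : ∀ {l u} → P l u ≡ true → up u ≡ (Sub.up l u <∣> c)
    up-piece {l} {u} e with P⁻ u e
    ... | _ , Su , refl rewrite Su = refl

    lift-ancestry : ∀ {l a b} → AncestorVia (Sub.up l) a b → P l b ≡ true → P l a ≡ true × AncestorVia up a b
    lift-ancestry {l} [ e ] Pb = Sub.up∈ l _ _ Pb e , [ trans (up-piece Pb) (cong (_<∣> c) e) ]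
    lift-ancestry {l} (e ∷ rest) Pb with lift-ancestry rest Pb
    ... | Py , anc = Sub.up∈ l _ _ Py e , (trans (up-piece Py) (cong (_<∣> c) e) ∷ anc)

    c-above : ∀ {y s} → X y ≡ true → S y ≡ false → c ≡ just s → AncestorVia up s (Sub.node (ℓ y) y)
    c-above {y} Xy Sy c≡s with root-above (sub (ℓ y)) _ (sub-node∈ Xy Sy)
    ... | ρ , Pρ , ρ-root , ρ-above = above ρ-above
      where
      ρ→s : up ρ ≡ just _
      ρ→s = trans (up-piece Pρ) (trans (cong (_<∣> c) ρ-root) c≡s)
      above : ρ ≡ Sub.node (ℓ y) y ⊎ AncestorVia (Sub.up (ℓ y)) ρ (Sub.node (ℓ y) y) →
              AncestorVia up _ (Sub.node (ℓ y) y)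
      above (inj₁ refl) = [ ρ→s ]
      above (inj₂ anc)  = ρ→s ∷ proj₂ (lift-ancestry anc (sub-node∈ Xy Sy))

    node∈ : ∀ x → X x ≡ true → X (node x) ≡ true
    node∈ x Xx with S x in Sx
    ... | true  = S⊆X _ (c∈S _ (c-just Sx))
    ... | false = proj₁ (P⁻ _ (sub-node∈ Xx Sx))

    colour< : ∀ x → X x ≡ true → colour x < m
    colour< x Xx with S x in Sx
    ... | true  = ≤-trans (rank<count S x Sx) |S|≤m
    ... | false = Sub.colour< (ℓ x) x (P⁺ Xx Sx)

    private
      centre∉node : ∀ {x y} → S x ≡ true → X y ≡ true → S y ≡ false → fromMaybe x c ≢ Sub.node (ℓ y) y
      centre∉node Sx Xy Sy e =
        true≢false (subst (λ z → S z ≡ true) e (c∈S _ (c-just Sx))) (proj₁ (proj₂ (P⁻ _ (sub-node∈ Xy Sy))))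

    injective : ∀ x y → X x ≡ true → X y ≡ true → node x ≡ node y → colour x ≡ colour y → x ≡ y
    injective x y Xx Xy same-node same-colour with S x in Sx | S y in Sy
    ... | true  | true  = rank-injective S Sx Sy same-colour
    ... | true  | false = ⊥-elim (centre∉node Sx Xy Sy same-node)
    ... | false | true  = ⊥-elim (centre∉node Sy Xx Sx (sym same-node))
    ... | false | false = Sub.injective (ℓ x) x y (P⁺ Xx Sx) (P-relabel Xy Sy (sym same-label))
        (trans same-node (cong (λ l → Sub.node l y) (sym same-label)))
        (trans same-colour (cong (λ l → Sub.colour l y) (sym same-label)))
      where
      label-node : ∀ {z} → X z ≡ true → S z ≡ false → ℓ (Sub.node (ℓ z) z) ≡ ℓ z
      label-node Xz Sz = proj₂ (proj₂ (P⁻ _ (sub-node∈ Xz Sz)))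
      same-label : ℓ x ≡ ℓ y
      same-label = trans (sym (label-node Xx Sx)) (trans (cong ℓ same-node) (label-node Xy Sy))

    edge : ∀ x y → X x ≡ true → X y ≡ true → adj G x y →
           node x ≡ node y ⊎ (AncestorVia up (node x) (node y) ⊎ AncestorVia up (node y) (node x))
    edge x y Xx Xy xy with S x in Sx | S y in Sy
    ... | true  | true  = inj₁ (just-injective (trans (sym (c-just Sx)) (c-just Sy)))
    ... | true  | false = inj₂ (inj₁ (c-above Xy Sy (c-just Sx)))
    ... | false | true  = inj₂ (inj₂ (c-above Xx Sx (c-just Sy)))
    ... | false | false with edge-label x y Xx Xy Sx Sy xy
    ...   | same-label rewrite same-label with Sub.edge (ℓ y) x y (P-relabel Xx Sx same-label) (P⁺ Xy Sy) xy
    ...     | inj₁ e          = inj₁ e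
    ...     | inj₂ (inj₁ anc) = inj₂ (inj₁ (proj₂ (lift-ancestry anc (Sub.node∈ (ℓ y) y (P⁺ Xy Sy)))))
    ...     | inj₂ (inj₂ anc) =
      inj₂ (inj₂ (proj₂ (lift-ancestry anc (Sub.node∈ (ℓ y) x (P-relabel Xx Sx same-label)))))

    up∈ : ∀ u w → X u ≡ true → up u ≡ just w → X w ≡ true
    up∈ u w Xu e with S u in Su
    up∈ u w Xu () | true
    ... | false with Sub.up (ℓ u) u in eu
    ...   | just _ with e
    ...     | refl = proj₁ (P⁻ _ (Sub.up∈ (ℓ u) u w (P⁺ Xu Su) eu))
    up∈ u w Xu e | false | nothing = S⊆X w (c∈S w e)

    level-root : ∀ u → X u ≡ true → up u ≡ nothing → level u ≡ 1
    level-root u Xu e with S u in Su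
    ... | true  = refl
    ... | false with Sub.up (ℓ u) u in eu
    level-root u Xu () | false | just _
    ...   | nothing = cong₂ _+_ (Sub.level-root (ℓ u) u (P⁺ Xu Su) eu) (cong (maybe′ _ 0) e)

    level-child : ∀ u w → X u ≡ true → up u ≡ just w → level u ≡ suc (level w)
    level-child u w Xu e with S u in Su
    level-child u w Xu () | true
    ... | false with Sub.up (ℓ u) u in eu
    ...   | just _ with e
    ...     | refl with P⁻ w (Sub.up∈ (ℓ u) u w (P⁺ Xu Su) eu)
    ...       | _ , Sw , ℓw≡ℓu rewrite Sw | ℓw≡ℓu = cong (_+ shift) (Sub.level-child (ℓ u) u w (P⁺ Xu Su) eu)
    level-child u w Xu e | false | nothing rewrite c∈S w e =
      cong₂ _+_ (Sub.level-root (ℓ u) u (P⁺ Xu Su) eu) (cong (maybe′ _ 0) e)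

    level≤ : ∀ u → X u ≡ true → level u ≤ suc j
    level≤ u Xu with S u in Su
    ... | true  = s≤s z≤n
    ... | false = subst (Sub.level (ℓ u) u + shift ≤_) (+-comm j 1)
                        (+-mono-≤ (Sub.level≤ (ℓ u) u (P⁺ Xu Su)) shift≤1)

    combine : Layout X (suc j)
    combine = record
      { node = node ; colour = colour ; up = up ; level = level
      ; node∈ = node∈ ; colour< = colour< ; injective = injective ; edge = edge ; up∈ = up∈
      ; level-root = level-root ; level-child = level-child ; level≤ = level≤ }

-- A set of size ≤ capacity k m (j + 1), separated at scale capacity k m j, uses at most ⌊m/(k+1)⌋ bags,
-- hence at most m separator vertices.
capacity : ℕ → ℕ → ℕ → ℕ
capacity k m zero    = m
capacity k m (suc j) = capacity k m j + (m / suc k) * suc (capacity k m j)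

module _ {n : ℕ} (G : FinGraph n) (k m : ℕ) (separation : ∀ X s → Separation G k X s) where

  private
    bags≤ : ∀ j q → q * suc (capacity k m j) ≤ capacity k m (suc j) → suc k * q ≤ m
    bags≤ j q q≤ =
      ≤-trans (*-monoʳ-≤ (suc k) q≤m/k+1) (subst (_≤ m) (*-comm (m / suc k) (suc k)) (m/n*n≤m m (suc k)))
      where
      q≤m/k+1 : q ≤ m / suc k
      q≤m/k+1 = ≤-pred (*-cancelʳ-< (suc (capacity k m j)) q (suc (m / suc k)) (s≤s q≤))

  layout : ∀ j (X : Fin n → Bool) → count X ≤ capacity k m j → Layout G m X (suc j)
  layout zero X |X|≤m with centre G m X
  ... | c , c∈X , c-none =
    Combine.combine G m X X (λ _ → 0) 0 (λ _ e → e) |X|≤m (λ _ _ Xx _ Sx _ _ → ⊥-elim (true≢false Xx Sx))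
      c c∈X c-none (λ l → empty-layout G m _ 0 (λ x → ∧-not-self (X x)))
    where
    ∧-not-self : ∀ b {c} → b ∧ (not b ∧ c) ≡ false
    ∧-not-self true  = refl
    ∧-not-self false = refl
  layout (suc j) X |X|≤ with separation X (capacity k m j)
  ... | sep with centre G m (Separation.separator sep)
  ... | c , c∈S , c-none =
    Combine.combine G m X separator label (suc j) separator⊆
      (≤-trans separator-size (bags≤ j bags (≤-trans bags-bound |X|≤))) edge-label c c∈S c-none
      (λ l → layout j _ (piece-size l))
    where open Separation sep

module _ (k m : ℕ) where

  m≤capacity : ∀ j → m ≤ capacity k m j
  m≤capacity zero    = ≤-refl
  m≤capacity (suc j) = ≤-trans (m≤capacity j) (m≤m+n _ _)

  private
    1+m≤ : suc m ≤ suc k * suc (m / suc k)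
    1+m≤ = begin
      suc m                                 ≡⟨ cong suc (m≡m%n+[m/n]*n m (suc k)) ⟩
      suc (m % suc k + m / suc k * suc k)   ≤⟨ +-monoˡ-≤ _ (m%n<n m (suc k)) ⟩
      suc k + m / suc k * suc k             ≡⟨ cong (suc k +_) (*-comm (m / suc k) (suc k)) ⟩
      suc k + suc k * (m / suc k)           ≡⟨ sym (*-suc (suc k) (m / suc k)) ⟩
      suc k * suc (m / suc k)               ∎
      where open ≤-Reasoning

  -- 1 + capacity k m j = (m + 1)(⌊m/(k+1)⌋ + 1)^j, and (k+1)(⌊m/(k+1)⌋ + 1) ≥ m + 1.
  capacity-growth : ∀ j → suc m ^ suc j ≤ suc k ^ j * suc (capacity k m j)
  capacity-growth zero    = ≤-reflexive (trans (*-identityʳ (suc m)) (sym (+-identityʳ (suc m))))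
  capacity-growth (suc j) = begin
    suc m * suc m ^ suc j
      ≤⟨ *-mono-≤ 1+m≤ (capacity-growth j) ⟩
    (suc k * suc (m / suc k)) * (suc k ^ j * suc (capacity k m j))
      ≡⟨ *-interchange (suc k) (suc (m / suc k)) (suc k ^ j) (suc (capacity k m j)) ⟩
    (suc k * suc k ^ j) * (suc (m / suc k) * suc (capacity k m j))
      ∎
    where open ≤-Reasoning

  ≤capacity : ∀ j n → n ≤ m ⊎ suc k ^ j * n < suc m ^ suc j → n ≤ capacity k m j
  ≤capacity j n (inj₁ n≤m)  = ≤-trans n≤m (m≤capacity j)
  ≤capacity j n (inj₂ small) =
    ≤-pred (*-cancelˡ-< (suc k ^ j) n (suc (capacity k m j)) (<-≤-trans small (capacity-growth j)))

largest-true : (P : ℕ → Set) → (∀ x → Dec (P x)) → P 0 → ∀ N → ∃ λ m → P m × (N ≤ m ⊎ ¬ P (suc m))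
largest-true P P? P0 zero = 0 , P0 , inj₁ z≤n
largest-true P P? P0 (suc N) with largest-true P P? P0 N
... | m , Pm , inj₂ ¬P1+m = m , Pm , inj₂ ¬P1+m
... | m , Pm , inj₁ N≤m with m≤n⇒m<n∨m≡n N≤m
...   | inj₁ N<m = m , Pm , inj₁ N<m
...   | inj₂ refl with P? (suc N)
...     | yes P1+N = suc N , P1+N , inj₁ ≤-refl
...     | no ¬P1+N = N , Pm , inj₂ ¬P1+N

module _ {n : ℕ} {G : FinGraph n} {m d : ℕ} (L : Layout G m (λ _ → true) d) where

  open Layout L

  private
    level< : ∀ {a b} → AncestorVia up a b → level a < level b
    level< {a} {b} [ e ]           = ≤-reflexive (sym (level-child b a refl e))
    level< {a} (_∷_ {y = y} e a<b) = <-trans (≤-reflexive (sym (level-child y a refl e))) (level< a<b)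

    forest : RootedForest n
    forest = record { parent = up ; depth = level
                    ; depthRoot = λ u → level-root u refl ; depthChild = λ u w → level-child u w refl }

    closure : FinGraph n
    closure = record
      { adj    = λ a b → AncestorVia up a b ⊎ AncestorVia up b a
      ; adjSym = λ { (inj₁ a<b) → inj₂ a<b ; (inj₂ b<a) → inj₁ b<a }
      ; adjIrr = λ { (inj₁ a<a) → <-irrefl refl (level< a<a) ; (inj₂ a<a) → <-irrefl refl (level< a<a) } }

    embed : Fin n → Fin n × Fin m
    embed x = node x , fromℕ< (colour< x refl)

    same-colour : ∀ {x y} → fromℕ< (colour< x refl) ≡ fromℕ< (colour< y refl) → colour x ≡ colour y
    same-colour {x} {y} e =
      trans (sym (Finₚ.toℕ-fromℕ< (colour< x refl))) (trans (cong toℕ e) (Finₚ.toℕ-fromℕ< (colour< y refl)))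

    embed-injective : ∀ {x y} → embed x ≡ embed y → x ≡ y
    embed-injective {x} {y} e = injective x y refl refl (cong proj₁ e) (same-colour (cong proj₂ e))

    embed-adj : ∀ {x y} → adj G x y → StrongAdj (toGraph closure) (Complete m) (embed x) (embed y)
    embed-adj {x} {y} xy with edge x y refl refl xy
    ... | inj₁ e = inj₁ (e , λ c → adjIrr G (subst (adj G x) (sym (injective x y refl refl e (same-colour c))) xy))
    ... | inj₂ anc with fromℕ< (colour< x refl) Finₚ.≟ fromℕ< (colour< y refl)
    ...   | yes c = inj₂ (inj₁ (c , anc))
    ...   | no  c = inj₂ (inj₂ (anc , c))

  layout⇒strong-product : Σ (FinGraph n) λ H → TreedepthAtMost H d × Contained (toGraph G) (toGraph H ⊠ Complete m)
  layout⇒strong-product = closure , (forest , id , λ u → level≤ u refl) , embed , embed-injective , embed-adj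

theorem10 : ∀ (d k n : ℕ) → 1 ≤ d → (G : FinGraph n) → TreewidthAtMost G k →
    Σ ℕ λ h → Σ (FinGraph h) λ H → Σ ℕ λ m →
      TreedepthAtMost H d × (m ^ d ≤ suc k ^ (d ∸ 1) * n) ×
      Contained (toGraph G) (toGraph H ⊠ Complete m)
theorem10 zero    _ _ () _ _
theorem10 (suc j) k n _  G tw
  with largest-true (λ m → m ^ suc j ≤ suc k ^ j * n) (λ m → m ^ suc j ≤? suc k ^ j * n) z≤n n
... | m , m^d≤ , maximal
  with layout⇒strong-product (layout G k m (separation tw) j (λ _ → true)
         (≤-trans (count≤n _) (≤capacity k m j n (map₂ ≰⇒> maximal))))
... | H , td , G⊆ = n , H , m , td , m^d≤ , G⊆
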